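{- For every formula $\varphi$ of epistemic logic, \[ \models_{\mathrm{EL}}\varphi \iff \models_{\mathrm{AK}} T(\varphi), \] i.e. $\varphi$ is true at every world of every EL model if and only if $T(\varphi)$ is true at every pair $(x,y)$ of every agent-knowledge model.
   Context: Epistemic logic: fix disjoint sets $\mathbf{Prop}$ (propositional variables) and $\mathbf{A}$ (agents). Formulas: $\varphi::=p\mid\neg\varphi\mid\varphi\wedge\varphi\mid K_i\varphi$ ($p\in\mathbf{Prop}$, $i\in\mathbf{A}$). An EL model is $(W,(R_i)_{i\in\mathbf{A}},V)$ with $W$ nonempty, each $R_i$ a binary relation on $W$, $V:\mathbf{Prop}\to\mathcal{P}(W)$; $w\models p$ iff $w\in V(p)$, Boolean clauses as usual, $w\models K_i\varphi$ iff $v\models\varphi$ for all $v$ with $wR_iv$. $\models_{\mathrm{EL}}\varphi$ means $\varphi$ holds at every world of every EL model. Agent-knowledge logic: fix pairwise disjoint sets $\mathbf{Prop}_A,\mathbf{Prop}_K,\mathbf{Nom}_A,\mathbf{Nom}_K$. Formulas: $\varphi ::= p_A\mid p_K\mid a\mid k\mid \neg\varphi\mid \varphi\wedge\varphi\mid \Box_A\varphi\mid\Box_K\varphi\mid @_a\varphi\mid @_k\varphi$ ($p_A\in\mathbf{Prop}_A$, $p_K\in\mathbf{Prop}_K$, $a\in\mathbf{Nom}_A$, $k\in\mathbf{Nom}_K$). An AK model is $(W_A,W_K,(R_y)_{y\in W_K},(S_x)_{x\in W_A},V_A,V_K)$ with $W_A,W_K$ nonempty, $R_y\subseteq W_A\times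 W_A$, $S_x\subseteq W_K\times W_K$, $V_A:\mathbf{Prop}_A\cup\mathbf{Nom}_A\to\mathcal{P}(W_A)$ with $V_A(a)=\{a^V\}$ a singleton for nominals $a$, $V_K:\mathbf{Prop}_K\cup\mathbf{Nom}_K\to\mathcal{P}(W_K)$ with $V_K(k)=\{k^V\}$ a singleton for nominals $k$. Satisfaction at $(x,y)\in W_A\times W_K$: $p_A$ iff $x\in V_A(p_A)$; $p_K$ iff $y\in V_K(p_K)$; $a$ iff $x=a^V$; $k$ iff $y=k^V$; Boolean clauses as usual; $\Box_A\varphi$ iff $\varphi$ at all $(x',y)$ with $xR_yx'$; $\Box_K\varphi$ iff $\varphi$ at all $(x,y')$ with $yS_xy'$; $@_a\varphi$ iff $\varphi$ at $(a^V,y)$; $@_k\varphi$ iff $\varphi$ at $(x,k^V)$. $\models_{\mathrm{AK}}\psi$ means $\psi$ holds at every pair of every AK model. Translation $T$: fix bijections $T:\mathbf{Prop}\to\mathbf{Prop}_K$ and $T:\mathbf{A}\to\mathbf{Nom}_A$, and extend by $T(\neg\varphi)=\neg T(\varphi)$, $T(\varphi\wedge\psi)=T(\varphi)\wedge T(\psi)$, $T(K_i\varphi)=@_{T(i)}\Box_K T(\varphi)$. -}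

module Defs where

open import Level using (Level; suc; _⊔_) renaming (zero to lzero)
open import Data.Product using (_×_; Σ)
open import Data.Empty using (⊥)
open import Relation.Nullary using (¬_)
open import Relation.Binary.PropositionalEquality using (_≡_)
open import Function.Bundles using (_⤖_; Bijection)

data ELForm (Prop Agt : Set) : Set where
  var : Prop → ELForm Prop Agt
  ¬ₑ_ : ELForm Prop Agt → ELForm Prop Agt
  _∧ₑ_ : ELForm Prop Agt → ELForm Prop Agt → ELForm Prop Agt
  K : Agt → ELForm Prop Agt → ELForm Prop Agt

record ELModel (Prop Agt : Set) : Set₁ where
  field
    W   : Set
    w₀  : W
    R   : Agt → W → W → Set
    V   : Prop → W → Set

module _ {Prop Agt : Set} (M : ELModel Prop Agt) where
  open ELModel M
  _⊨ₑ_ : W → ELForm Prop Agt → Set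
  w ⊨ₑ var p   = V p w
  w ⊨ₑ (¬ₑ φ)  = ¬ (w ⊨ₑ φ)
  w ⊨ₑ (φ ∧ₑ ψ) = (w ⊨ₑ φ) × (w ⊨ₑ ψ)
  w ⊨ₑ K i φ   = ∀ v → R i w v → v ⊨ₑ φ

ELValid : {Prop Agt : Set} → ELForm Prop Agt → Set₁
ELValid {Prop} {Agt} φ = ∀ (M : ELModel Prop Agt) (w : ELModel.W M) → _⊨ₑ_ M w φ

data AKForm (PropA PropK NomA NomK : Set) : Set where
  pA  : PropA → AKForm PropA PropK NomA NomK
  pK  : PropK → AKForm PropA PropK NomA NomK
  nA  : NomA → AKForm PropA PropK NomA NomK
  nK  : NomK → AKForm PropA PropK NomA NomK
  ¬ₐ_ : AKForm PropA PropK NomA NomK → AKForm PropA PropK NomA NomK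
  _∧ₐ_ : AKForm PropA PropK NomA NomK → AKForm PropA PropK NomA NomK → AKForm PropA PropK NomA NomK
  □A  : AKForm PropA PropK NomA NomK → AKForm PropA PropK NomA NomK
  □K  : AKForm PropA PropK NomA NomK → AKForm PropA PropK NomA NomK
  atA  : NomA → AKForm PropA PropK NomA NomK → AKForm PropA PropK NomA NomK
  atK  : NomK → AKForm PropA PropK NomA NomK → AKForm PropA PropK NomA NomK

-- An AK model. Nominal valuations are singletons, represented by the
-- denoted element: V_A(a) = {nomA a}, V_K(k) = {nomK k}.
record AKModel (PropA PropK NomA NomK : Set) : Set₁ where
  field
    WA   : Set
    WK   : Set
    xa₀  : WA
    yk₀  : WK
    R    : WK → WA → WA → Set
    S    : WA → WK → WK → Set
    VA   : PropA → WA → Set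
    VK   : PropK → WK → Set
    nomA : NomA → WA
    nomK : NomK → WK

module _ {PropA PropK NomA NomK : Set} (M : AKModel PropA PropK NomA NomK) where
  open AKModel M
  _,_⊨ₐ_ : WA → WK → AKForm PropA PropK NomA NomK → Set
  x , y ⊨ₐ pA p     = VA p x
  x , y ⊨ₐ pK p     = VK p y
  x , y ⊨ₐ nA a     = x ≡ nomA a
  x , y ⊨ₐ nK k     = y ≡ nomK k
  x , y ⊨ₐ (¬ₐ φ)   = ¬ (x , y ⊨ₐ φ)
  x , y ⊨ₐ (φ ∧ₐ ψ) = (x , y ⊨ₐ φ) × (x , y ⊨ₐ ψ)
  x , y ⊨ₐ □A φ     = ∀ x' → R y x x' → x' , y ⊨ₐ φ
  x , y ⊨ₐ □K φ     = ∀ y' → S x y y' → x , y' ⊨ₐ φ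
  x , y ⊨ₐ atA a φ   = nomA a , y ⊨ₐ φ
  x , y ⊨ₐ atK k φ   = x , nomK k ⊨ₐ φ

AKValid : {PropA PropK NomA NomK : Set} → AKForm PropA PropK NomA NomK → Set₁
AKValid {PropA} {PropK} {NomA} {NomK} ψ =
  ∀ (M : AKModel PropA PropK NomA NomK) (x : AKModel.WA M) (y : AKModel.WK M) →
    _,_⊨ₐ_ M x y ψ

module Translation {Prop Agt PropA PropK NomA NomK : Set}
                   (tP : Prop ⤖ PropK) (tA : Agt ⤖ NomA) where
  T : ELForm Prop Agt → AKForm PropA PropK NomA NomK
  T (var p)  = pK (Bijection.to tP p)
  T (¬ₑ φ)   = ¬ₐ T φ
  T (φ ∧ₑ ψ) = T φ ∧ₐ T ψ
  T (K i φ)  = atA (Bijection.to tA i) (□K (T φ))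

-- An AK model viewed from its knowledge side is an EL model: its worlds are
-- the knowledge states, and agent i accesses them through S at the agent
-- state named by T(i).  Since T(K_i φ) = @_{T(i)} □_K T(φ) always jumps to
-- that agent state, T(φ) holds at (x , y) exactly when φ holds at y in this
-- reduct, whatever x is.  Conversely every EL model is, up to equivalent
-- accessibility relations and valuation, the reduct of an AK model whose
-- agent states are the agent nominals.  So validity transfers both ways.
module Submission where

open import Defs
open import Data.Empty using (⊥)
open import Data.Maybe using (Maybe; just; nothing)
open import Data.Product using (Σ; _×_; _,_)
open import Data.Product.Function.NonDependent.Propositional using (_×-⇔_)
open import Function.Base using (id)
open import Function.Bundles using (_⤖_; _⇔_; mk⇔; Bijection; Equivalence)
open import Function.Related.TypeIsomorphisms using (¬-cong-⇔)
open import Relation.Binary.PropositionalEquality using (_≡_; refl; subst)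

open Equivalence using (to; from)

module _ {Prop Agt : Set} (M : ELModel Prop Agt) where
  open ELModel M

  ⊨ₑ-resp-⇔ : (R′ : Agt → W → W → Set) (V′ : Prop → W → Set) →
              (∀ i w v → R i w v ⇔ R′ i w v) → (∀ p w → V p w ⇔ V′ p w) →
              ∀ φ w → _⊨ₑ_ M w φ ⇔ _⊨ₑ_ (record M { R = R′ ; V = V′ }) w φ
  ⊨ₑ-resp-⇔ R′ V′ R⇔R′ V⇔V′ = go
    where
    go : ∀ φ w → _⊨ₑ_ M w φ ⇔ _⊨ₑ_ (record M { R = R′ ; V = V′ }) w φ
    go (var p)  w = V⇔V′ p w
    go (¬ₑ φ)   w = ¬-cong-⇔ (go φ w)
    go (φ ∧ₑ ψ) w = go φ w ×-⇔ go ψ w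
    go (K i φ)  w = mk⇔
      (λ □φ v wR′v → to (go φ v) (□φ v (from (R⇔R′ i w v) wR′v)))
      (λ □φ v wRv → from (go φ v) (□φ v (to (R⇔R′ i w v) wRv)))

preimage-⇔ : {A B : Set} (f : A ⤖ B) (P : A → Set) (a : A) →
             P a ⇔ (Σ A λ a′ → Bijection.to f a′ ≡ Bijection.to f a × P a′)
preimage-⇔ f P a = mk⇔
  (λ Pa → a , refl , Pa)
  (λ { (a′ , fa′≡fa , Pa′) → subst P (Bijection.injective f fa′≡fa) Pa′ })

module Correspondence {Prop Agt PropA PropK NomA NomK : Set}
                     (tP : Prop ⤖ PropK) (tA : Agt ⤖ NomA) where
  open Translation {PropA = PropA} {NomK = NomK} tP tA
  open Bijection tP using () renaming (to to propK)
  open Bijection tA using () renaming (to to agentNom)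

  knowledgeReduct : AKModel PropA PropK NomA NomK → ELModel Prop Agt
  knowledgeReduct M = record
    { W  = WK
    ; w₀ = yk₀
    ; R  = λ i → S (nomA (agentNom i))
    ; V  = λ p → VK (propK p)
    }
    where open AKModel M

  ⊨ₑ-knowledgeReduct⇔⊨ₐ-T : (M : AKModel PropA PropK NomA NomK) →
    ∀ φ x y → _⊨ₑ_ (knowledgeReduct M) y φ ⇔ _,_⊨ₐ_ M x y (T φ)
  ⊨ₑ-knowledgeReduct⇔⊨ₐ-T M = go
    where
    go : ∀ φ x y → _⊨ₑ_ (knowledgeReduct M) y φ ⇔ _,_⊨ₐ_ M x y (T φ)
    go (var p)  x y = mk⇔ id id
    go (¬ₑ φ)   x y = ¬-cong-⇔ (go φ x y)
    go (φ ∧ₑ ψ) x y = go φ x y ×-⇔ go ψ x y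
    go (K i φ)  x y = mk⇔
      (λ □φ y′ ySy′ → to   (go φ _ y′) (□φ y′ ySy′))
      (λ □φ y′ ySy′ → from (go φ _ y′) (□φ y′ ySy′))

  -- The agent state nothing only makes W_A nonempty when there are no agent
  -- nominals.  □_A, Prop_A and K-nominals never occur in T φ, so R, VA and
  -- nomK are arbitrary.
  agentExpansion : ELModel Prop Agt → AKModel PropA PropK NomA NomK
  agentExpansion N = record
    { WA   = Maybe NomA
    ; WK   = W
    ; xa₀  = nothing
    ; yk₀  = w₀
    ; R    = λ _ _ _ → ⊥
    ; S    = S
    ; VA   = λ _ _ → ⊥
    ; VK   = λ q y → Σ Prop λ p → propK p ≡ q × V p y
    ; nomA = just
    ; nomK = λ _ → w₀
    }
    where
    open ELModel N
    S : Maybe NomA → W → W → Set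
    S (just a) y y′ = Σ Agt λ i → agentNom i ≡ a × R i y y′
    S nothing  y y′ = ⊥

  ⊨ₑ-⇔-knowledgeReduct-agentExpansion : (N : ELModel Prop Agt) →
    ∀ φ w → _⊨ₑ_ N w φ ⇔ _⊨ₑ_ (knowledgeReduct (agentExpansion N)) w φ
  ⊨ₑ-⇔-knowledgeReduct-agentExpansion N = ⊨ₑ-resp-⇔ N _ _
    (λ i w v → preimage-⇔ tA (λ j → R j w v) i)
    (λ p w → preimage-⇔ tP (λ p′ → V p′ w) p)
    where open ELModel N

mainTheorem2 : {Prop Agt PropA PropK NomA NomK : Set} →
    (tP : Prop ⤖ PropK) → (tA : Agt ⤖ NomA) →
    (φ : ELForm Prop Agt) →
    ELValid φ ⇔ AKValid (Translation.T {PropA = PropA} {NomK = NomK} tP tA φ)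
mainTheorem2 {PropA = PropA} {NomK = NomK} tP tA φ = mk⇔
  (λ valid M x y → to (⊨ₑ-knowledgeReduct⇔⊨ₐ-T M φ x y) (valid (knowledgeReduct M) y))
  (λ valid N w → from (⊨ₑ-⇔-knowledgeReduct-agentExpansion N φ w)
                   (from (⊨ₑ-knowledgeReduct⇔⊨ₐ-T (agentExpansion N) φ nothing w)
                     (valid (agentExpansion N) nothing w)))
  where open Correspondence {PropA = PropA} {NomK = NomK} tP tA
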